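{- Let $p$ and $q$ be distinct primes and $n = p^2 q$. Then the non-nilradical graph $\Omega(\mathbb{Z}_n)$ is not a very cost effective graph.
   Context: $\mathbb{Z}_n$ is the ring of residue classes modulo $n$. The non-nilradical graph $\Omega(\mathbb{Z}_n)$ has as vertices the non-nilpotent (nonzero) zero-divisors of $\mathbb{Z}_n$, two distinct vertices $x,y$ being adjacent iff $xy=0$. For a graph $G=(V,E)$, $N(v)$ denotes the open neighborhood of $v$. Given $S \subseteq V$, a vertex $v \in S$ is very cost effective if $|N(v)\cap S| < |N(v) \cap (V\setminus S)|$; a set $S$ is very cost effective if every vertex of $S$ is very cost effective. A bipartition $\{S, V\setminus S\}$ is very cost effective if both parts are very cost effective sets, and $G$ is a very cost effective graph if it has a very cost effective bipartition. -}

module Defs where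

open import Data.Nat using (ℕ; suc; _*_; _^_; _<_)
open import Data.Nat.Divisibility using (_∣_)
open import Data.Fin using (Fin; toℕ)
open import Data.Bool using (Bool; not)
open import Data.Product using (Σ; ∃; _×_)
open import Relation.Nullary using (¬_)
open import Relation.Binary.PropositionalEquality using (_≡_; _≢_)
open import Function.Bundles using (_↔_)

record Graph : Set₁ where
  field
    V   : Set
    Adj : V → V → Set

HasSize : Set → ℕ → Set
HasSize A m = A ↔ Fin m

module _ (G : Graph) where
  open Graph G

  -- Neighbours of v lying on side b of the bipartition S (i.e. N(v) ∩ S or
  -- N(v) ∩ (V ∖ S)).  Proof fields are irrelevant, so two such neighbours are
  -- equal iff they are the same vertex.
  record NbrOn (S : V → Bool) (b : Bool) (v : V) : Set where
    constructor nbr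
    field
      u     : V
      .adj  : Adj v u
      .side : S u ≡ b

  VeryCostEffectiveVertex : (S : V → Bool) → (b : Bool) → V → Set
  VeryCostEffectiveVertex S b v =
    Σ ℕ λ a → Σ ℕ λ c →
      HasSize (NbrOn S b v) a × HasSize (NbrOn S (not b) v) c × a < c

  VeryCostEffectiveSet : (S : V → Bool) → Bool → Set
  VeryCostEffectiveSet S b = ∀ v → S v ≡ b → VeryCostEffectiveVertex S b v

  VeryCostEffectiveBipartition : (V → Bool) → Set
  VeryCostEffectiveBipartition S =
    VeryCostEffectiveSet S Bool.true × VeryCostEffectiveSet S Bool.false
    where import Data.Bool as Bool

  VeryCostEffectiveGraph : Set
  VeryCostEffectiveGraph = ∃ λ (S : V → Bool) → VeryCostEffectiveBipartition S

-- Elements of ℤ_n are represented by Fin n (residues 0 … n-1).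
-- x is a zero-divisor: x ≠ 0 and x·y = 0 in ℤ_n for some y ≠ 0.
IsZeroDivisor : (n : ℕ) → Fin n → Set
IsZeroDivisor n x = toℕ x ≢ 0 × ∃ λ (y : Fin n) → toℕ y ≢ 0 × n ∣ toℕ x * toℕ y
  where open import Data.Nat using (zero)

IsNilpotent : (n : ℕ) → Fin n → Set
IsNilpotent n x = ∃ λ (k : ℕ) → n ∣ toℕ x ^ suc k

record ΩVertex (n : ℕ) : Set where
  constructor vtx
  field
    elt     : Fin n
    .zd     : IsZeroDivisor n elt
    .nonnil : ¬ IsNilpotent n elt

ΩAdj : (n : ℕ) → ΩVertex n → ΩVertex n → Set
ΩAdj n x y = ΩVertex.elt x ≢ ΩVertex.elt y × n ∣ toℕ (ΩVertex.elt x) * toℕ (ΩVertex.elt y)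

Ω : ℕ → Graph
Ω n = record { V = ΩVertex n ; Adj = ΩAdj n }

-- Idea: the residue p is a vertex of Ω(ℤ_{p²q}) without neighbours.  It is
-- a zero-divisor (p · pq = 0) and not nilpotent (q ∤ p^k), but anything it
-- annihilates is a multiple of pq and hence squares to 0, i.e. is nilpotent
-- and not a vertex.  An isolated vertex has 0 neighbours on either side of
-- any bipartition, and 0 < 0 fails, so it is never very cost effective;
-- whichever part contains it, the bipartition is not very cost effective.
module Submission where

open import Defs
open import Data.Nat using (ℕ; zero; suc; _*_; _^_; _<_; NonZero; ≢-nonZero⁻¹; nonTrivial⇒n>1; nonTrivial⇒≢1)
open import Data.Nat.Properties using (*-identityʳ; *-assoc; *-comm; m<m*n; m≤n*m; <-≤-trans; m*n≢0)
open import Data.Nat.Divisibility using (_∣_; ∣-refl; ∣-trans; n∣m*n; m∣m*n; *-pres-∣; *-cancelˡ-∣)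
open import Data.Nat.Primality using (Prime; euclidsLemma; prime⇒irreducible; prime⇒nonZero; prime⇒nonTrivial)
open import Data.Fin using (Fin; toℕ; fromℕ<) renaming (zero to fzero)
open import Data.Fin.Properties using (toℕ-fromℕ<)
open import Data.Bool using (true; false)
open import Data.Product using (_,_)
open import Data.Sum using (inj₁; inj₂)
open import Data.Empty using (⊥-elim-irr)
open import Relation.Nullary using (¬_)
open import Relation.Binary.PropositionalEquality using (_≡_; _≢_; refl; sym; trans; cong; subst; subst₂)
open import Function.Bundles using (Inverse)

-- An empty type has size 0: any element of Fin (suc c) would pull back.
empty⇒size0 : {A : Set} {c : ℕ} → HasSize A c → ¬ A → c ≡ 0
empty⇒size0 {c = zero}  _    _     = refl
empty⇒size0 {c = suc c} size empty with empty (Inverse.from size fzero)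
... | ()

module _ (G : Graph) where
  open Graph G

  Isolated : V → Set
  Isolated v = ∀ u → ¬ Adj v u

  isolated⇒¬veryCostEffectiveVertex : ∀ {v} → Isolated v →
    ∀ S b → ¬ VeryCostEffectiveVertex G S b v
  isolated⇒¬veryCostEffectiveVertex iso S b (a , c , _ , otherSide , a<c)
    with empty⇒size0 otherSide (λ (nbr u adj _) → ⊥-elim-irr (iso u adj))
  isolated⇒¬veryCostEffectiveVertex iso S b (a , .0 , _ , _ , ()) | refl

  isolated⇒¬veryCostEffectiveGraph : ∀ v → Isolated v → ¬ VeryCostEffectiveGraph G
  isolated⇒¬veryCostEffectiveGraph v iso (S , inS , outS) with S v in side
  ... | true  = isolated⇒¬veryCostEffectiveVertex iso S true  (inS  v side)
  ... | false = isolated⇒¬veryCostEffectiveVertex iso S false (outS v side)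

-- A prime dividing a power divides the base (iterated Euclid's lemma).
prime∣power⇒prime∣base : ∀ {m q} → Prime q → ∀ k → q ∣ m ^ suc k → q ∣ m
prime∣power⇒prime∣base {m} {q} _  zero    q∣m¹ = subst (q ∣_) (*-identityʳ m) q∣m¹
prime∣power⇒prime∣base {m}     pq (suc k) q∣mᵏ⁺² with euclidsLemma m (m ^ suc k) pq q∣mᵏ⁺²
... | inj₁ q∣m   = q∣m
... | inj₂ q∣mᵏ⁺¹ = prime∣power⇒prime∣base pq k q∣mᵏ⁺¹

prime∤distinctPrime : ∀ {p q} → Prime p → Prime q → p ≢ q → ¬ q ∣ p
prime∤distinctPrime pp pq p≢q q∣p with prime⇒irreducible pp q∣p
... | inj₁ q≡1 = nonTrivial⇒≢1 {{prime⇒nonTrivial pq}} q≡1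
... | inj₂ q≡p = p≢q (sym q≡p)

p²q≡p*pq : ∀ p q → p ^ 2 * q ≡ p * (p * q)
p²q≡p*pq p q = trans (cong (λ p² → p * p² * q) (*-identityʳ p)) (*-assoc p p q)

module _ (p q : ℕ) (pp : Prime p) (pq : Prime q) (p≢q : p ≢ q) where
  instance
    p≢0 : NonZero p
    p≢0 = prime⇒nonZero pp
    q≢0 : NonZero q
    q≢0 = prime⇒nonZero pq

  n : ℕ
  n = p ^ 2 * q

  p<n : p < n
  p<n = subst (p <_) (sym (p²q≡p*pq p q))
    (m<m*n p (p * q) (<-≤-trans (nonTrivial⇒n>1 q {{prime⇒nonTrivial pq}}) (m≤n*m q p)))

  pq<n : p * q < n
  pq<n = subst (p * q <_) (trans (*-comm (p * q) p) (sym (p²q≡p*pq p q)))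
    (m<m*n (p * q) p {{m*n≢0 p q}} (nonTrivial⇒n>1 p {{prime⇒nonTrivial pp}}))

  resP resPQ : Fin n
  resP  = fromℕ< p<n
  resPQ = fromℕ< pq<n

  resP-zeroDivisor : IsZeroDivisor n resP
  resP-zeroDivisor =
      (λ p≡0 → ≢-nonZero⁻¹ p (trans (sym (toℕ-fromℕ< p<n)) p≡0))
    , resPQ
    , (λ pq≡0 → ≢-nonZero⁻¹ (p * q) {{m*n≢0 p q}} (trans (sym (toℕ-fromℕ< pq<n)) pq≡0))
    , subst₂ (λ a b → n ∣ a * b) (sym (toℕ-fromℕ< p<n)) (sym (toℕ-fromℕ< pq<n))
        (subst (_∣ p * (p * q)) (sym (p²q≡p*pq p q)) ∣-refl)

  -- p^k is never 0 in ℤ_n, since q ∤ p^k.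
  resP-nonNilpotent : ¬ IsNilpotent n resP
  resP-nonNilpotent (k , n∣pᵏ⁺¹) = prime∤distinctPrime pp pq p≢q
    (prime∣power⇒prime∣base pq k
      (∣-trans (n∣m*n (p ^ 2)) (subst (λ r → n ∣ r ^ suc k) (toℕ-fromℕ< p<n) n∣pᵏ⁺¹)))

  resP-vertex : ΩVertex n
  resP-vertex = vtx resP resP-zeroDivisor resP-nonNilpotent

  -- Everything annihilated by p is a multiple of pq, so its square is a
  -- multiple of p²q² and thus 0: it is nilpotent.
  annihilatedByP⇒nilpotent : ∀ y → n ∣ p * toℕ y → IsNilpotent n y
  annihilatedByP⇒nilpotent y n∣py = 1 ,
    subst (n ∣_) (cong (toℕ y *_) (sym (*-identityʳ (toℕ y))))
      (subst (_∣ toℕ y * toℕ y) (sym (p²q≡p*pq p q)) (*-pres-∣ p∣y pq∣y))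
    where
    pq∣y : p * q ∣ toℕ y
    pq∣y = *-cancelˡ-∣ p (subst (_∣ p * toℕ y) (p²q≡p*pq p q) n∣py)
    p∣y : p ∣ toℕ y
    p∣y = ∣-trans (m∣m*n q) pq∣y

  resP-isolated : Isolated (Ω n) resP-vertex
  resP-isolated (vtx y _ nonNil) (_ , n∣py) =
    ⊥-elim-irr (nonNil (annihilatedByP⇒nilpotent y
      (subst (λ r → n ∣ r * toℕ y) (toℕ-fromℕ< p<n) n∣py)))

mainTheorem6 : (p q : ℕ) → Prime p → Prime q → p ≢ q →
               ¬ VeryCostEffectiveGraph (Ω (p ^ 2 * q))
mainTheorem6 p q pp pq p≢q =
  isolated⇒¬veryCostEffectiveGraph (Ω (p ^ 2 * q))
    (resP-vertex p q pp pq p≢q) (resP-isolated p q pp pq p≢q)
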